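{- Let $k\le m$ be positive integers and $n=\frac{m}{\gcd(m,k)}$. For $i\in[n]$ let $B_i=\{(j \bmod m)+1: j\in[(i-1)k,\,ik-1]\}\subseteq[m]$, and for $j\in[m]$ let $C_j=\{i\in[n]: j\in B_i\}$. Then $\{C_1,\dots,C_m\}$ is a regular $(n,nk,k,m;k)$-MCBC, in which every server stores exactly $\frac{k}{\gcd(m,k)}$ items.
   Context: An $(n,N,k,m;r)$ multiset combinatorial batch code (MCBC) is a collection $\mathcal C=\{C_1,\dots,C_m\}$ of subsets of $[n]=\{1,\dots,n\}$ (servers) with $N=\sum_{j=1}^m|C_j|$, such that for every multiset request $\{i_1,\dots,i_k\}$ of $k$ elements of $[n]$ in which every element has multiplicity at most $r$, there exist subsets $D_j\subseteq C_j$ with $|D_j|\le 1$ ($j\in[m]$) whose multiset union (the multiplicity of $i$ being $|\{j: i\in D_j\}|$) contains the request. An MCBC is regular if all servers store the same number of items, i.e. $|C_1|=\dots=|C_m|$. Here $j\bmod m\in\{0,\dots,m-1\}$ and $[a,b]=\{a,\dots,b\}$. -}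

module Defs where

open import Data.Nat using (ℕ; zero; suc; _+_; _*_; _≤_; NonZero; ≢-nonZero; ≢-nonZero⁻¹; _≡ᵇ_)
open import Data.Nat.DivMod using (_/_; _%_)
open import Data.Nat.GCD using (gcd; gcd[m,n]≢0)
open import Data.Fin using (Fin; toℕ; _≟_)
open import Data.Fin.Subset using (Subset; _∈_; ∣_∣)
open import Data.Vec using (Vec; tabulate; lookup; sum)
open import Data.Bool using (Bool; true; false; if_then_else_; _∨_)
open import Data.Maybe using (Maybe; just; nothing)
open import Data.Product using (_×_; ∃)
open import Data.Sum using (inj₁)
open import Relation.Nullary.Decidable using (⌊_⌋)
open import Relation.Binary.PropositionalEquality using (_≡_)

ΣF : ∀ {n} → (Fin n → ℕ) → ℕ
ΣF f = sum (tabulate f)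

-- |D_j ∩ {i}| where a subset D_j of size ≤ 1 is encoded as a Maybe.
hit : ∀ {n} → Maybe (Fin n) → Fin n → ℕ
hit nothing  i = 0
hit (just i′) i = if ⌊ i′ ≟ i ⌋ then 1 else 0

mult : ∀ {n m} → (Fin m → Maybe (Fin n)) → Fin n → ℕ
mult d i = ΣF (λ j → hit (d j) i)

-- A multiset request of k items with multiplicities ≤ r is a function
-- req : Fin n → ℕ with total k and every value ≤ r.
-- D_j ⊆ C_j with |D_j| ≤ 1 is d j : Maybe (Fin n) with d j = just i ⇒ i ∈ C j.
IsMCBC : (n N k m r : ℕ) → (Fin m → Subset n) → Set
IsMCBC n N k m r C =
  ΣF (λ j → ∣ C j ∣) ≡ N ×
  ((req : Fin n → ℕ) → ΣF req ≡ k → (∀ i → req i ≤ r) →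
    ∃ λ (d : Fin m → Maybe (Fin n)) →
      (∀ j i → d j ≡ just i → i ∈ C j) × (∀ i → req i ≤ mult d i))

IsRegular : ∀ {n m} → (Fin m → Subset n) → Set
IsRegular C = ∀ j j′ → ∣ C j ∣ ≡ ∣ C j′ ∣

gcd-nonZero : ∀ m k → .{{NonZero m}} → NonZero (gcd m k)
gcd-nonZero m k {{nz}} = ≢-nonZero (gcd[m,n]≢0 m k (inj₁ (≢-nonZero⁻¹ m {{nz}})))

nOf : (m k : ℕ) → .{{nz : NonZero m}} → ℕ
nOf m k {{_}} = _/_ m (gcd m k) {{gcd-nonZero m k}}

anyBelow : ℕ → (ℕ → Bool) → Bool
anyBelow zero    p = false
anyBelow (suc k) p = anyBelow k p ∨ p k

-- B_i (0-indexed: item i ∈ Fin n, server j ∈ Fin m):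
-- B_i = { (t mod m) : t ∈ [i k, i k + k - 1] }, i.e. paper's B_{i+1} shifted by one.
B : (m k : ℕ) → .{{nz : NonZero m}} → Fin (nOf m k) → Subset m
B m k {{_}} i = tabulate λ j → anyBelow k (λ t → toℕ j ≡ᵇ ((toℕ i * k + t) % m))

C : (m k : ℕ) → .{{nz : NonZero m}} → Fin m → Subset (nOf m k)
C m k {{_}} j = tabulate λ i → lookup (B m k i) j

module Submission where

-- Write g = gcd(m,k), n = m/g and q = k/g, so that n·k = q·m.
-- Item i occupies the "window" B_i of the k consecutive residues
-- i·k, …, i·k+k-1 modulo m.  Since k ≤ m these residues are pairwise
-- distinct, so the indicator of "j ∈ B_i" equals the number of t < k with
-- j ≡ i·k+t (mod m).  Two counts follow:
--   * every item lies on exactly k servers (a window has k elements);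
--   * every server j lies in exactly q windows: the windows B_0, …, B_{n-1}
--     together list the residues of 0, 1, …, n·k-1 = q·m-1, and every
--     residue occurs exactly q times among these.
-- The second count gives |C_j| = q, hence regularity and N = m·q = n·k.
-- Retrieval is a general greedy argument: if every item is stored on at
-- least k servers, any request of total size at most k is served one copy
-- at a time, because fewer than k servers are busy at each step, so some
-- server storing the next requested item is still free.

open import Defs
open import Data.Nat
  using (ℕ; zero; suc; _+_; _*_; _∸_; _≤_; _<_; z≤n; s≤s; NonZero; >-nonZero; _≡ᵇ_)
open import Data.Nat.Properties hiding (_≟_)
open import Data.Nat.DivMod using (_/_; _%_; m≡m%n+[m/n]*n; m%n<n; [m+kn]%n≡m%n; m<n⇒m%n≡m; m/n*n≡m)
open import Data.Nat.Divisibility using (_∣_; divides; ∣⇒≤)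
open import Data.Nat.GCD using (gcd; gcd[m,n]∣m; gcd[m,n]∣n)
open import Data.Fin using (Fin; zero; suc; toℕ; _≟_)
open import Data.Fin.Properties using (toℕ<n; any?)
import Data.Fin.Properties as Fin
open import Data.Fin.Subset using (Subset; _∈_; ∣_∣)
open import Data.Fin.Subset.Properties using (_∈?_)
open import Data.Vec using (tabulate; lookup)
open import Data.Vec.Properties using (lookup∘tabulate; lookup⇒[]=)
open import Data.Bool using (Bool; true; false; if_then_else_; _∨_; T)
open import Data.Bool.Properties using (∨-identityʳ; ∨-zeroʳ)
import Data.Bool.Properties as Bool
open import Data.Maybe using (Maybe; just; nothing; is-just)
import Data.Maybe.Properties as Maybe
open import Data.Product using (∃; ∃₂; _×_; _,_)
open import Data.Empty using (⊥; ⊥-elim)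
open import Relation.Nullary using (yes; no; does; _×-dec_)
open import Relation.Binary.PropositionalEquality
open import Algebra.Properties.CommutativeSemigroup +-commutativeSemigroup using (interchange)

𝟙 : Bool → ℕ
𝟙 true  = 1
𝟙 false = 0

-- Σ_{t<n} f t over a range of naturals, peeling off the top term (this
-- matches the recursion of anyBelow).
sumBelow : ℕ → (ℕ → ℕ) → ℕ
sumBelow zero    f = 0
sumBelow (suc n) f = sumBelow n f + f n

sumBelow-cong : ∀ n {f g : ℕ → ℕ} → (∀ t → t < n → f t ≡ g t) → sumBelow n f ≡ sumBelow n g
sumBelow-cong zero    f≗g = refl
sumBelow-cong (suc n) f≗g =
  cong₂ _+_ (sumBelow-cong n (λ t t<n → f≗g t (m<n⇒m<1+n t<n))) (f≗g n ≤-refl)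

sumBelow-const : ∀ n c → sumBelow n (λ _ → c) ≡ n * c
sumBelow-const zero    c = refl
sumBelow-const (suc n) c = trans (cong (_+ c) (sumBelow-const n c)) (+-comm (n * c) c)

sumBelow-vanish : ∀ n {f : ℕ → ℕ} → (∀ t → t < n → f t ≡ 0) → sumBelow n f ≡ 0
sumBelow-vanish n f≡0 = trans (sumBelow-cong n f≡0) (trans (sumBelow-const n 0) (*-zeroʳ n))

sumBelow-+ : ∀ n (f g : ℕ → ℕ) → sumBelow n (λ t → f t + g t) ≡ sumBelow n f + sumBelow n g
sumBelow-+ zero    f g = refl
sumBelow-+ (suc n) f g =
  trans (cong (_+ (f n + g n)) (sumBelow-+ n f g)) (interchange (sumBelow n f) _ _ _)

sumBelow-swap : ∀ a b (f : ℕ → ℕ → ℕ) →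
  sumBelow a (λ x → sumBelow b (f x)) ≡ sumBelow b (λ y → sumBelow a (λ x → f x y))
sumBelow-swap zero    b f = sym (sumBelow-vanish b (λ _ _ → refl))
sumBelow-swap (suc a) b f =
  trans (cong (_+ sumBelow b (f a)) (sumBelow-swap a b f)) (sym (sumBelow-+ b _ (f a)))

sumBelow-split : ∀ a b (f : ℕ → ℕ) → sumBelow (a + b) f ≡ sumBelow a f + sumBelow b (λ x → f (a + x))
sumBelow-split a zero    f = trans (cong (λ z → sumBelow z f) (+-identityʳ a)) (sym (+-identityʳ _))
sumBelow-split a (suc b) f = begin
  sumBelow (a + suc b) f                                  ≡⟨ cong (λ z → sumBelow z f) (+-suc a b) ⟩
  sumBelow (a + b) f + f (a + b)                          ≡⟨ cong (_+ f (a + b)) (sumBelow-split a b f) ⟩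
  sumBelow a f + sumBelow b (λ x → f (a + x)) + f (a + b) ≡⟨ +-assoc (sumBelow a f) _ _ ⟩
  sumBelow a f + sumBelow (suc b) (λ x → f (a + x))       ∎
  where open ≡-Reasoning

sumBelow-blocks : ∀ n k (f : ℕ → ℕ) →
  sumBelow n (λ i → sumBelow k (λ t → f (i * k + t))) ≡ sumBelow (n * k) f
sumBelow-blocks zero    k f = refl
sumBelow-blocks (suc n) k f = begin
  sumBelow n (λ i → sumBelow k (λ t → f (i * k + t))) + sumBelow k (λ t → f (n * k + t))
    ≡⟨ cong (_+ sumBelow k (λ t → f (n * k + t))) (sumBelow-blocks n k f) ⟩
  sumBelow (n * k) f + sumBelow k (λ t → f (n * k + t))
    ≡⟨ sym (sumBelow-split (n * k) k f) ⟩
  sumBelow (n * k + k) f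
    ≡⟨ cong (λ z → sumBelow z f) (+-comm (n * k) k) ⟩
  sumBelow (k + n * k) f ∎
  where open ≡-Reasoning

sumBelow-shift : ∀ n (f : ℕ → ℕ) → sumBelow (suc n) f ≡ f 0 + sumBelow n (λ t → f (suc t))
sumBelow-shift n f = trans (sumBelow-split 1 n f) (cong (_+ sumBelow n (λ t → f (suc t))) (+-identityˡ (f 0)))

ΣF-toℕ : ∀ n (f : ℕ → ℕ) → ΣF {n} (λ i → f (toℕ i)) ≡ sumBelow n f
ΣF-toℕ zero    f = refl
ΣF-toℕ (suc n) f = trans (cong (f 0 +_) (ΣF-toℕ n (λ t → f (suc t)))) (sym (sumBelow-shift n f))

ΣF-cong : ∀ {n} {f g : Fin n → ℕ} → (∀ i → f i ≡ g i) → ΣF f ≡ ΣF g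
ΣF-cong {zero}  f≗g = refl
ΣF-cong {suc n} f≗g = cong₂ _+_ (f≗g zero) (ΣF-cong (λ i → f≗g (suc i)))

ΣF-mono : ∀ {n} {f g : Fin n → ℕ} → (∀ i → f i ≤ g i) → ΣF f ≤ ΣF g
ΣF-mono {zero}  f≤g = z≤n
ΣF-mono {suc n} f≤g = +-mono-≤ (f≤g zero) (ΣF-mono (λ i → f≤g (suc i)))

ΣF-const : ∀ n c → ΣF {n} (λ _ → c) ≡ n * c
ΣF-const n c = trans (ΣF-toℕ n (λ _ → c)) (sumBelow-const n c)

ΣF≡0 : ∀ {n} (f : Fin n → ℕ) → ΣF f ≡ 0 → ∀ i → f i ≡ 0
ΣF≡0 f sum≡0 zero    = m+n≡0⇒m≡0 (f zero) sum≡0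
ΣF≡0 f sum≡0 (suc i) = ΣF≡0 (λ i → f (suc i)) (m+n≡0⇒n≡0 (f zero) sum≡0) i

ΣF-point : ∀ {n} (f g : Fin n → ℕ) (j : Fin n) (a : ℕ) →
  (∀ j′ → j′ ≢ j → g j′ ≡ f j′) → g j ≡ f j + a → ΣF g ≡ ΣF f + a
ΣF-point {suc n} f g zero a off at = begin
  g zero + ΣF (λ i → g (suc i))     ≡⟨ cong₂ _+_ at (ΣF-cong (λ i → off (suc i) (λ ()))) ⟩
  f zero + a + ΣF (λ i → f (suc i)) ≡⟨ +-assoc (f zero) a _ ⟩
  f zero + (a + ΣF (λ i → f (suc i))) ≡⟨ cong (f zero +_) (+-comm a _) ⟩
  f zero + (ΣF (λ i → f (suc i)) + a) ≡⟨ +-assoc (f zero) _ a ⟨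
  f zero + ΣF (λ i → f (suc i)) + a ∎
  where open ≡-Reasoning
ΣF-point {suc n} f g (suc j) a off at =
  trans (cong₂ _+_ (off zero (λ ()))
                   (ΣF-point (λ i → f (suc i)) (λ i → g (suc i)) j a
                     (λ j′ j′≢j → off (suc j′) (λ e → j′≢j (Fin.suc-injective e))) at))
        (sym (+-assoc (f zero) _ a))

∣tabulate∣ : ∀ {n} (f : Fin n → Bool) → ∣ tabulate f ∣ ≡ ΣF (λ i → 𝟙 (f i))
∣tabulate∣ {zero}  f = refl
∣tabulate∣ {suc n} f = trans (count-step (f zero) _) (cong (𝟙 (f zero) +_) (∣tabulate∣ (λ i → f (suc i))))
  where
  count-step : ∀ b x → (if does (b Bool.≟ true) then suc else (λ z → z)) x ≡ 𝟙 b + x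
  count-step true  x = refl
  count-step false x = refl

≡ᵇ-true : ∀ a b → (a ≡ᵇ b) ≡ true → a ≡ b
≡ᵇ-true a b eq = ≡ᵇ⇒≡ a b (subst T (sym eq) _)

≡ᵇ-sym : ∀ a b → (a ≡ᵇ b) ≡ (b ≡ᵇ a)
≡ᵇ-sym zero    zero    = refl
≡ᵇ-sym zero    (suc b) = refl
≡ᵇ-sym (suc a) zero    = refl
≡ᵇ-sym (suc a) (suc b) = ≡ᵇ-sym a b

𝟙-≡ᵇ-refl : ∀ a → 𝟙 (a ≡ᵇ a) ≡ 1
𝟙-≡ᵇ-refl zero    = refl
𝟙-≡ᵇ-refl (suc a) = 𝟙-≡ᵇ-refl a

𝟙-≡ᵇ-≢ : ∀ a b → a ≢ b → 𝟙 (a ≡ᵇ b) ≡ 0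
𝟙-≡ᵇ-≢ a b a≢b with a ≡ᵇ b in eq
... | true  = ⊥-elim (a≢b (≡ᵇ-true a b eq))
... | false = refl

point-count : ∀ m y → y < m → sumBelow m (λ t → 𝟙 (t ≡ᵇ y)) ≡ 1
point-count (suc m) y y<1+m with m Data.Nat.≟ y
... | yes refl = cong₂ _+_ (sumBelow-vanish m (λ t t<m → 𝟙-≡ᵇ-≢ t m (<⇒≢ t<m))) (𝟙-≡ᵇ-refl m)
... | no m≢y   = cong₂ _+_ (point-count m y (≤∧≢⇒< (≤-pred y<1+m) (≢-sym m≢y))) (𝟙-≡ᵇ-≢ m y m≢y)

anyBelow-count : ∀ K (p : ℕ → Bool) →
  (∀ {t u} → t < u → u < K → p t ≡ true → p u ≡ true → ⊥) →
  𝟙 (anyBelow K p) ≡ sumBelow K (λ t → 𝟙 (p t))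
anyBelow-count zero    p once = refl
anyBelow-count (suc K) p once with p K in pK
... | false = begin
  𝟙 (anyBelow K p ∨ false)         ≡⟨ cong 𝟙 (∨-identityʳ _) ⟩
  𝟙 (anyBelow K p)                 ≡⟨ anyBelow-count K p (λ t<u u<K → once t<u (m<n⇒m<1+n u<K)) ⟩
  sumBelow K (λ t → 𝟙 (p t))       ≡⟨ +-identityʳ _ ⟨
  sumBelow K (λ t → 𝟙 (p t)) + 0   ∎
  where open ≡-Reasoning
... | true  = trans (cong 𝟙 (∨-zeroʳ _)) (sym (cong (_+ 1) (sumBelow-vanish K below)))
  where
  below : ∀ t → t < K → 𝟙 (p t) ≡ 0
  below t t<K with p t in pt
  ... | true  = ⊥-elim (once t<K ≤-refl pt pK)
  ... | false = refl

%-≡⇒∣∸ : ∀ x y m .{{_ : NonZero m}} → x % m ≡ y % m → m ∣ y ∸ x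
%-≡⇒∣∸ x y m same = divides (y / m ∸ x / m) (begin
  y ∸ x                                   ≡⟨ cong₂ _∸_ (m≡m%n+[m/n]*n y m) (m≡m%n+[m/n]*n x m) ⟩
  (y % m + y / m * m) ∸ (x % m + x / m * m) ≡⟨ cong (λ r → (r + y / m * m) ∸ (x % m + x / m * m)) (sym same) ⟩
  (x % m + y / m * m) ∸ (x % m + x / m * m) ≡⟨ [m+n]∸[m+o]≡n∸o (x % m) _ _ ⟩
  y / m * m ∸ x / m * m                   ≡⟨ *-distribʳ-∸ m (y / m) (x / m) ⟨
  (y / m ∸ x / m) * m                     ∎)
  where open ≡-Reasoning

window-residues-distinct : ∀ c m .{{_ : NonZero m}} {t u} → t < u → u < m → (c + t) % m ≢ (c + u) % m
window-residues-distinct c m {t} {u} t<u u<m same = <⇒≱ gap<m m≤gap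
  where
  instance
    gap≢0 : NonZero (u ∸ t)
    gap≢0 = >-nonZero (m<n⇒0<n∸m t<u)
  m≤gap : m ≤ u ∸ t
  m≤gap = ∣⇒≤ (subst (m ∣_) ([m+n]∸[m+o]≡n∸o c u t) (%-≡⇒∣∸ (c + t) (c + u) m same))
  gap<m : u ∸ t < m
  gap<m = ≤-<-trans (m∸n≤m u t) u<m

inWindow : (m k c J : ℕ) .{{_ : NonZero m}} → Bool
inWindow m k c J = anyBelow k (λ t → J ≡ᵇ (c + t) % m)

-- For k ≤ m each residue occurs at most once in a window, so membership
-- counts the hits.
window-indicator : ∀ m k c J .{{_ : NonZero m}} → k ≤ m →
  𝟙 (inWindow m k c J) ≡ sumBelow k (λ t → 𝟙 (J ≡ᵇ (c + t) % m))
window-indicator m k c J k≤m = anyBelow-count k (λ t → J ≡ᵇ (c + t) % m) at-most-once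
  where
  at-most-once : ∀ {t u} → t < u → u < k → (J ≡ᵇ (c + t) % m) ≡ true → (J ≡ᵇ (c + u) % m) ≡ true → ⊥
  at-most-once t<u u<k hit-t hit-u = window-residues-distinct c m t<u (<-≤-trans u<k k≤m)
    (trans (sym (≡ᵇ-true J _ hit-t)) (≡ᵇ-true J _ hit-u))

window-size : ∀ m k c .{{_ : NonZero m}} → k ≤ m → sumBelow m (λ J → 𝟙 (inWindow m k c J)) ≡ k
window-size m k c k≤m = begin
  sumBelow m (λ J → 𝟙 (inWindow m k c J))
    ≡⟨ sumBelow-cong m (λ J _ → window-indicator m k c J k≤m) ⟩
  sumBelow m (λ J → sumBelow k (λ t → 𝟙 (J ≡ᵇ (c + t) % m)))
    ≡⟨ sumBelow-swap m k (λ J t → 𝟙 (J ≡ᵇ (c + t) % m)) ⟩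
  sumBelow k (λ t → sumBelow m (λ J → 𝟙 (J ≡ᵇ (c + t) % m)))
    ≡⟨ sumBelow-cong k (λ t _ → point-count m ((c + t) % m) (m%n<n (c + t) m)) ⟩
  sumBelow k (λ _ → 1)
    ≡⟨ trans (sumBelow-const k 1) (*-identityʳ k) ⟩
  k ∎
  where open ≡-Reasoning

residue-count : ∀ q m J .{{_ : NonZero m}} → J < m → sumBelow (q * m) (λ s → 𝟙 (J ≡ᵇ s % m)) ≡ q
residue-count q m J J<m = begin
  sumBelow (q * m) (λ s → 𝟙 (J ≡ᵇ s % m))
    ≡⟨ sumBelow-blocks q m _ ⟨
  sumBelow q (λ a → sumBelow m (λ t → 𝟙 (J ≡ᵇ (a * m + t) % m)))
    ≡⟨ sumBelow-cong q (λ a _ → trans (sumBelow-cong m (λ t t<m → block-term a t t<m)) (point-count m J J<m)) ⟩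
  sumBelow q (λ _ → 1)
    ≡⟨ trans (sumBelow-const q 1) (*-identityʳ q) ⟩
  q ∎
  where
  open ≡-Reasoning
  block-term : ∀ a t → t < m → 𝟙 (J ≡ᵇ (a * m + t) % m) ≡ 𝟙 (t ≡ᵇ J)
  block-term a t t<m = cong 𝟙 (trans (cong (J ≡ᵇ_) residue) (≡ᵇ-sym J t))
    where
    residue : (a * m + t) % m ≡ t
    residue = trans (cong (_% m) (+-comm (a * m) t)) (trans ([m+kn]%n≡m%n t a m) (m<n⇒m%n≡m t<m))

window-cover : ∀ nn k m q J .{{_ : NonZero m}} → k ≤ m → J < m → nn * k ≡ q * m →
  sumBelow nn (λ i → 𝟙 (inWindow m k (i * k) J)) ≡ q
window-cover nn k m q J k≤m J<m nk≡qm = begin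
  sumBelow nn (λ i → 𝟙 (inWindow m k (i * k) J))
    ≡⟨ sumBelow-cong nn (λ i _ → window-indicator m k (i * k) J k≤m) ⟩
  sumBelow nn (λ i → sumBelow k (λ t → 𝟙 (J ≡ᵇ (i * k + t) % m)))
    ≡⟨ sumBelow-blocks nn k (λ s → 𝟙 (J ≡ᵇ s % m)) ⟩
  sumBelow (nn * k) (λ s → 𝟙 (J ≡ᵇ s % m))
    ≡⟨ cong (λ z → sumBelow z (λ s → 𝟙 (J ≡ᵇ s % m))) nk≡qm ⟩
  sumBelow (q * m) (λ s → 𝟙 (J ≡ᵇ s % m))
    ≡⟨ residue-count q m J J<m ⟩
  q ∎
  where open ≡-Reasoning

peel : ∀ {n} (f : Fin n → ℕ) {s} → ΣF f ≡ suc s →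
  ∃₂ λ (x : Fin n) (f′ : Fin n → ℕ) → ΣF f′ ≡ s × (∀ i → f i ≤ f′ i + hit (just x) i)
peel {suc n} f {s} total with f zero in f0
... | suc a = zero , rest , suc-injective total , bound
  where
  rest : Fin (suc n) → ℕ
  rest zero    = a
  rest (suc i) = f (suc i)
  bound : ∀ i → f i ≤ rest i + hit (just zero) i
  bound zero    = ≤-reflexive (trans f0 (+-comm 1 a))
  bound (suc i) = m≤m+n (f (suc i)) 0
... | zero with peel (λ i → f (suc i)) total
...   | x , f′ , total′ , bound′ = suc x , rest , total′ , bound
  where
  rest : Fin (suc n) → ℕ
  rest zero    = 0
  rest (suc i) = f′ i
  hit-suc : ∀ i → hit (just (suc x)) (suc i) ≡ hit (just x) i
  hit-suc i with x ≟ i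
  ... | yes _ = refl
  ... | no  _ = refl
  bound : ∀ i → f i ≤ rest i + hit (just (suc x)) i
  bound zero    = ≤-reflexive f0
  bound (suc i) = subst (f (suc i) ≤_) (cong (f′ i +_) (sym (hit-suc i))) (bound′ i)

module Retrieval {n m} (C : Fin m → Subset n) where

  -- A choice of at most one item per server (d j = nothing: server idle).
  Choice : Set
  Choice = Fin m → Maybe (Fin n)

  Respects : Choice → Set
  Respects d = ∀ j i → d j ≡ just i → i ∈ C j

  busy : Choice → ℕ
  busy d = ΣF (λ j → 𝟙 (is-just (d j)))

  degree : Fin n → ℕ
  degree x = ΣF (λ j → 𝟙 (lookup (C j) x))

  free-server : ∀ (d : Choice) x → busy d < degree x → ∃ λ j → x ∈ C j × d j ≡ nothing
  free-server d x busy<degree with any? (λ j → (x ∈? C j) ×-dec Maybe.≡-dec _≟_ (d j) nothing)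
  ... | yes found = found
  ... | no  none  = ⊥-elim (<⇒≱ busy<degree (ΣF-mono stored⇒busy))
    where
    stored⇒busy : ∀ j → 𝟙 (lookup (C j) x) ≤ 𝟙 (is-just (d j))
    stored⇒busy j with lookup (C j) x in stored | d j in dj
    ... | false | _       = z≤n
    ... | true  | just _  = ≤-refl
    ... | true  | nothing = ⊥-elim (none (j , lookup⇒[]= x (C j) stored , dj))

  assign : Choice → Fin m → Fin n → Choice
  assign d j x j′ = if does (j′ ≟ j) then just x else d j′

  assign-respects : ∀ d j x → Respects d → x ∈ C j → Respects (assign d j x)
  assign-respects d j x resp x∈Cj j′ i eq with j′ ≟ j
  assign-respects d j x resp x∈Cj j′ i refl | yes refl = x∈Cj
  ... | no _ = resp j′ i eq

  assign-sum : ∀ d j x (g : Maybe (Fin n) → ℕ) → g nothing ≡ 0 → d j ≡ nothing →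
    ΣF (λ j′ → g (assign d j x j′)) ≡ ΣF (λ j′ → g (d j′)) + g (just x)
  assign-sum d j x g g0 idle = ΣF-point _ _ j (g (just x)) elsewhere here
    where
    elsewhere : ∀ j′ → j′ ≢ j → g (assign d j x j′) ≡ g (d j′)
    elsewhere j′ j′≢j with j′ ≟ j
    ... | yes j′≡j = ⊥-elim (j′≢j j′≡j)
    ... | no  _    = refl
    here : g (assign d j x j) ≡ g (d j) + g (just x)
    here with j ≟ j
    ... | yes _  = sym (cong (_+ g (just x)) (trans (cong g idle) g0))
    ... | no j≢j = ⊥-elim (j≢j refl)

  serve : ∀ k → (∀ x → k ≤ degree x) → ∀ s (req : Fin n → ℕ) → ΣF req ≡ s → s ≤ k →
    ∃ λ (d : Choice) → Respects d × (∀ i → req i ≤ mult d i) × busy d ≤ s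
  serve k enough zero req total _ =
    (λ _ → nothing) , (λ _ _ ()) , (λ i → subst (_≤ _) (sym (ΣF≡0 req total i)) z≤n) ,
    ≤-reflexive (trans (ΣF-const m 0) (*-zeroʳ m))
  serve k enough (suc s) req total s<k with peel req total
  ... | x , req′ , total′ , split with serve k enough s req′ total′ (<⇒≤ s<k)
  ...   | d , resp , covered , busy≤s with free-server d x (≤-<-trans busy≤s (<-≤-trans s<k (enough x)))
  ...     | j , x∈Cj , idle = assign d j x , assign-respects d j x resp x∈Cj , covered′ , busy′
    where
    covered′ : ∀ i → req i ≤ mult (assign d j x) i
    covered′ i = ≤-trans (split i) (subst (req′ i + hit (just x) i ≤_)
      (sym (assign-sum d j x (λ o → hit o i) refl idle)) (+-monoˡ-≤ _ (covered i)))
    busy′ : busy (assign d j x) ≤ suc s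
    busy′ = subst (_≤ suc s) (sym (assign-sum d j x (λ o → 𝟙 (is-just o)) refl idle))
      (subst (_≤ suc s) (+-comm 1 _) (s≤s busy≤s))

B-entry : ∀ m k .{{_ : NonZero m}} (i : Fin (nOf m k)) (j : Fin m) →
  lookup (B m k i) j ≡ inWindow m k (toℕ i * k) (toℕ j)
B-entry m k i = lookup∘tabulate (λ j′ → inWindow m k (toℕ i * k) (toℕ j′))

C-entry : ∀ m k .{{_ : NonZero m}} (j : Fin m) (i : Fin (nOf m k)) →
  lookup (C m k j) i ≡ inWindow m k (toℕ i * k) (toℕ j)
C-entry m k j i = trans (lookup∘tabulate (λ i′ → lookup (B m k i′) j) i) (B-entry m k i j)

item-degree : ∀ m k .{{_ : NonZero m}} → k ≤ m → ∀ x → Retrieval.degree (C m k) x ≡ k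
item-degree m k k≤m x = begin
  ΣF (λ j → 𝟙 (lookup (C m k j) x))             ≡⟨ ΣF-cong (λ j → cong 𝟙 (C-entry m k j x)) ⟩
  ΣF {m} (λ j → 𝟙 (inWindow m k (toℕ x * k) (toℕ j))) ≡⟨ ΣF-toℕ m (λ J → 𝟙 (inWindow m k (toℕ x * k) J)) ⟩
  sumBelow m (λ J → 𝟙 (inWindow m k (toℕ x * k) J)) ≡⟨ window-size m k (toℕ x * k) k≤m ⟩
  k ∎
  where open ≡-Reasoning

server-load : ∀ m k q .{{_ : NonZero m}} → k ≤ m → nOf m k * k ≡ q * m → ∀ j → ∣ C m k j ∣ ≡ q
server-load m k q k≤m nk≡qm j = begin
  ∣ C m k j ∣                                         ≡⟨ ∣tabulate∣ (λ i → lookup (B m k i) j) ⟩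
  ΣF (λ i → 𝟙 (lookup (B m k i) j))                   ≡⟨ ΣF-cong (λ i → cong 𝟙 (B-entry m k i j)) ⟩
  ΣF {nOf m k} (λ i → 𝟙 (inWindow m k (toℕ i * k) (toℕ j))) ≡⟨ ΣF-toℕ (nOf m k) (λ i → 𝟙 (inWindow m k (i * k) (toℕ j))) ⟩
  sumBelow (nOf m k) (λ i → 𝟙 (inWindow m k (i * k) (toℕ j))) ≡⟨ window-cover (nOf m k) k m q (toℕ j) k≤m (toℕ<n j) nk≡qm ⟩
  q ∎
  where open ≡-Reasoning

gcd-cross : ∀ m k .{{_ : NonZero (gcd m k)}} → (m / gcd m k) * k ≡ (k / gcd m k) * m
gcd-cross m k = begin
  m / g * k           ≡⟨ cong (m / g *_) (m/n*n≡m (gcd[m,n]∣n m k)) ⟨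
  m / g * (k / g * g) ≡⟨ *-assoc (m / g) (k / g) g ⟨
  m / g * (k / g) * g ≡⟨ cong (_* g) (*-comm (m / g) (k / g)) ⟩
  k / g * (m / g) * g ≡⟨ *-assoc (k / g) (m / g) g ⟩
  k / g * (m / g * g) ≡⟨ cong (k / g *_) (m/n*n≡m (gcd[m,n]∣m m k)) ⟩
  k / g * m ∎
  where
  open ≡-Reasoning
  g = gcd m k

theorem14 : (k m : ℕ) → .{{_ : NonZero k}} → .{{_ : NonZero m}} → k ≤ m →
    IsMCBC (nOf m k) (nOf m k * k) k m k (C m k) ×
    IsRegular (C m k) ×
    (∀ j → ∣ C m k j ∣ ≡ _/_ k (gcd m k) {{gcd-nonZero m k}})
theorem14 k m k≤m = (storage , retrieval) , regular , load
  where
  instance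
    g≢0 : NonZero (gcd m k)
    g≢0 = gcd-nonZero m k
  q = k / gcd m k
  nk≡qm : nOf m k * k ≡ q * m
  nk≡qm = gcd-cross m k
  load : ∀ j → ∣ C m k j ∣ ≡ q
  load = server-load m k q k≤m nk≡qm
  regular : IsRegular (C m k)
  regular j j′ = trans (load j) (sym (load j′))
  storage : ΣF (λ j → ∣ C m k j ∣) ≡ nOf m k * k
  storage = trans (ΣF-cong load) (trans (ΣF-const m q) (trans (*-comm m q) (sym nk≡qm)))
  open Retrieval (C m k) using (serve)
  retrieval : (req : Fin (nOf m k) → ℕ) → ΣF req ≡ k → (∀ i → req i ≤ k) →
    ∃ λ (d : Fin m → Maybe (Fin (nOf m k))) →
      (∀ j i → d j ≡ just i → i ∈ C m k j) × (∀ i → req i ≤ mult d i)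
  -- the multiplicity bound r = k is implied by the total size k
  retrieval req total _
    with serve k (λ x → ≤-reflexive (sym (item-degree m k k≤m x))) k req total ≤-refl
  ... | d , respects , covered , _ = d , respects , covered
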